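{- For all integers $m,n\geq 3$, $\lambda_1^1(P_m \times P_n)=4$.
   Context: For a graph $G$, an $L(1,1)$-labeling with labels in $\{0,1,\dots,p\}$ is a function $l:V(G)\to\{0,1,\dots,p\}$ such that $l(u)\neq l(v)$ whenever the distance $d(u,v)$ is $1$ or $2$. $\lambda_1^1(G)$ denotes the least $p$ for which $G$ admits such a labeling. $P_m$ denotes the path with $m$ vertices (length $m-1$). The direct product $G\times H$ has vertex set $V(G)\times V(H)$, with $(x_1,x_2)$ adjacent to $(y_1,y_2)$ iff $x_1y_1\in E(G)$ and $x_2y_2\in E(H)$. -}

module Defs where

open import Level using (0ℓ)
open import Data.Nat using (ℕ; suc; _≤_)
open import Data.Fin using (Fin; toℕ)
open import Data.Product using (Σ; ∃; _×_)
import Data.Product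
open import Data.Sum using (_⊎_)
open import Relation.Nullary using (¬_)
open import Relation.Binary.PropositionalEquality using (_≡_)

record Graph : Set₁ where
  field
    V   : Set
    Adj : V → V → Set

open Graph public

-- d(u,v) ∈ {1,2}: u ≠ v and (u ~ v, or u and v have a common neighbour).
-- (For the graphs below adjacency is irreflexive, so this is exactly d = 1 or d = 2.)
Dist12 : (G : Graph) → V G → V G → Set
Dist12 G u v = ¬ (u ≡ v) × (Adj G u v ⊎ Σ (V G) λ w → Adj G u w × Adj G w v)

IsL11Labeling : (G : Graph) (p : ℕ) → (V G → Fin (suc p)) → Set
IsL11Labeling G p l = ∀ u v → Dist12 G u v → ¬ (l u ≡ l v)

HasL11Labeling : Graph → ℕ → Set
HasL11Labeling G p = Σ (V G → Fin (suc p)) λ l → IsL11Labeling G p l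

λ11≡ : Graph → ℕ → Set
λ11≡ G p = HasL11Labeling G p × (∀ q → HasL11Labeling G q → p ≤ q)

Path : ℕ → Graph
Path m = record
  { V   = Fin m
  ; Adj = λ i j → (toℕ j ≡ suc (toℕ i)) ⊎ (toℕ i ≡ suc (toℕ j))
  }

_×ᵍ_ : Graph → Graph → Graph
G ×ᵍ H = record
  { V   = V G × V H
  ; Adj = λ x y → Adj G (Data.Product.proj₁ x) (Data.Product.proj₁ y)
                × Adj H (Data.Product.proj₂ x) (Data.Product.proj₂ y)
  }

module Submission where

open import Defs
open import Data.Nat using (ℕ; NonZero; suc; _+_; _*_; _%_; _≤_; _≥_; s≤s) renaming (_≟_ to _≟ₙ_)
open import Data.Nat.DivMod using (_mod_; m%n<n; %-distribˡ-+; [m+n]%n≡m%n)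
open import Data.Nat.Properties using (+-comm; suc-injective; ≮⇒≥)
open import Data.Fin as Fin using (Fin; toℕ)
open import Data.Fin.Patterns using (0F; 1F; 2F; 3F; 4F)
open import Data.Fin.Properties using (toℕ-fromℕ<; toℕ-injective; all?; _≟_; pigeonhole; <⇒≢)
open import Data.Product using (∃-syntax; _×_; _,_)
open import Data.Sum using (_⊎_; inj₁; inj₂)
open import Data.Empty using (⊥-elim)
open import Function using (_∘_)
open import Relation.Binary.PropositionalEquality
  using (_≡_; _≢_; refl; sym; trans; cong; cong₂; module ≡-Reasoning)
open import Relation.Nullary.Decidable using (toWitness; _→-dec_)

-- Upper bound: label (i, j) by i + 2j mod 5. Moving to a vertex at distance 1 or 2 shifts
-- (i, j) by (±1, ±1), or by (0 or ±2, 0 or ±2) but not (0, 0); the label then changes by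
-- ±1, ±3, ±2, ±4 or ±6, never by a multiple of 5.
-- Lower bound: the centre (1, 1) of a 3 × 3 corner is adjacent to the four corners
-- (0, 0), (0, 2), (2, 0), (2, 2), which therefore pairwise share a neighbour; these five
-- vertices need five distinct labels.

Step : ℕ → ℕ → Set
Step a b = b ≡ suc a ⊎ a ≡ suc b

_⊕_ : ∀ {n} .{{_ : NonZero n}} → Fin n → Fin n → Fin n
_⊕_ {n} a b = (toℕ a + toℕ b) mod n

toℕ-mod : ∀ a n .{{_ : NonZero n}} → toℕ (a mod n) ≡ a % n
toℕ-mod a n = toℕ-fromℕ< (m%n<n a n)

mod-+ : ∀ a b n .{{_ : NonZero n}} → (a + b) mod n ≡ (a mod n) ⊕ (b mod n)
mod-+ a b n = toℕ-injective (begin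
  toℕ ((a + b) mod n)                  ≡⟨ toℕ-mod (a + b) n ⟩
  (a + b) % n                          ≡⟨ %-distribˡ-+ a b n ⟩
  (a % n + b % n) % n                  ≡⟨ cong₂ (λ x y → (x + y) % n) (toℕ-mod a n) (toℕ-mod b n) ⟨
  (toℕ (a mod n) + toℕ (b mod n)) % n  ≡⟨ toℕ-mod (toℕ (a mod n) + toℕ (b mod n)) n ⟨
  toℕ ((a mod n) ⊕ (b mod n))          ∎)
  where open ≡-Reasoning

mod-periodic : ∀ a n .{{_ : NonZero n}} → (n + a) mod n ≡ a mod n
mod-periodic a n = toℕ-injective (begin
  toℕ ((n + a) mod n)  ≡⟨ toℕ-mod (n + a) n ⟩
  (n + a) % n          ≡⟨ cong (_% n) (+-comm n a) ⟩
  (a + n) % n          ≡⟨ [m+n]%n≡m%n a n ⟩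
  a % n                ≡⟨ toℕ-mod a n ⟨
  toℕ (a mod n)        ∎)
  where open ≡-Reasoning

ℤ₅ : Set
ℤ₅ = Fin 5

[_] : ℕ → ℤ₅
[ a ] = a mod 5

data UnitShift : ℤ₅ → Set where
  up   : UnitShift 1F
  down : UnitShift 4F

data DoubleShift : ℤ₅ → Set where
  up₂   : DoubleShift 2F
  down₂ : DoubleShift 3F

step-shift : ∀ {a b} → Step a b → ∃[ d ] UnitShift d × [ b ] ≡ d ⊕ [ a ]
step-shift {a} (inj₁ refl) = 1F , up , mod-+ 1 a 5
step-shift {b = b} (inj₂ refl) = 4F , down , trans (sym (mod-periodic b 5)) (mod-+ 4 (suc b) 5)

twoStep-shift : ∀ {a c b} → Step a c → Step c b → a ≡ b ⊎ ∃[ d ] DoubleShift d × [ b ] ≡ d ⊕ [ a ]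
twoStep-shift {a} (inj₁ refl) (inj₁ refl) = inj₂ (2F , up₂ , mod-+ 2 a 5)
twoStep-shift (inj₁ refl) (inj₂ c≡suc-b) = inj₁ (suc-injective c≡suc-b)
twoStep-shift (inj₂ a≡suc-c) (inj₁ refl) = inj₁ a≡suc-c
twoStep-shift {b = b} (inj₂ refl) (inj₂ refl) =
  inj₂ (3F , down₂ , trans (sym (mod-periodic b 5)) (mod-+ 3 (2 + b) 5))

stay-shift : ∀ {a b} → a ≡ b → [ b ] ≡ 0F ⊕ [ a ]
stay-shift {a} refl = mod-+ 0 a 5

grid : ℤ₅ → ℤ₅ → ℤ₅
grid x y = x ⊕ (y ⊕ y)

-- grid is additive, so a shift fixes it only if grid vanishes on the shift; checked exhaustively.
grid-shift⇒grid≡0 : ∀ d e x y → grid (d ⊕ x) (e ⊕ y) ≡ grid x y → grid d e ≡ 0F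
grid-shift⇒grid≡0 = toWitness {a? = all? λ d → all? λ e → all? λ x → all? λ y →
  (grid (d ⊕ x) (e ⊕ y) ≟ grid x y) →-dec (grid d e ≟ 0F)} _

grid-separates : ∀ d e x y {x′ y′} → x′ ≡ d ⊕ x → y′ ≡ e ⊕ y → grid d e ≢ 0F → grid x y ≢ grid x′ y′
grid-separates d e x y refl refl grid≢0 eq = grid≢0 (grid-shift⇒grid≡0 d e x y (sym eq))

grid-unit-unit : ∀ {d e} → UnitShift d → UnitShift e → grid d e ≢ 0F
grid-unit-unit up   up   ()
grid-unit-unit up   down ()
grid-unit-unit down up   ()
grid-unit-unit down down ()

grid-double-double : ∀ {d e} → DoubleShift d → DoubleShift e → grid d e ≢ 0F
grid-double-double up₂   up₂   ()
grid-double-double up₂   down₂ ()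
grid-double-double down₂ up₂   ()
grid-double-double down₂ down₂ ()

grid-double-0 : ∀ {d} → DoubleShift d → grid d 0F ≢ 0F
grid-double-0 up₂   ()
grid-double-0 down₂ ()

grid-0-double : ∀ {e} → DoubleShift e → grid 0F e ≢ 0F
grid-0-double up₂   ()
grid-0-double down₂ ()

pathProduct-label : ∀ {m n} → Fin m × Fin n → ℤ₅
pathProduct-label (i , j) = grid [ toℕ i ] [ toℕ j ]

pathProduct-label-isL11 : ∀ m n → IsL11Labeling (Path m ×ᵍ Path n) 4 pathProduct-label
pathProduct-label-isL11 m n (i , j) (i′ , j′) (_ , inj₁ (i~i′ , j~j′))
  with step-shift i~i′ | step-shift j~j′
... | d , d-unit , p | e , e-unit , q =
  grid-separates d e [ toℕ i ] [ toℕ j ] p q (grid-unit-unit d-unit e-unit)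
pathProduct-label-isL11 m n (i , j) (i′ , j′) (u≢v , inj₂ (_ , (i~k , j~l) , (k~i′ , l~j′)))
  with twoStep-shift i~k k~i′ | twoStep-shift j~l l~j′
... | inj₁ i≡i′ | inj₁ j≡j′ =
  λ _ → u≢v (cong₂ _,_ (toℕ-injective i≡i′) (toℕ-injective j≡j′))
... | inj₁ i≡i′ | inj₂ (e , e-double , q) =
  grid-separates 0F e [ toℕ i ] [ toℕ j ] (stay-shift i≡i′) q (grid-0-double e-double)
... | inj₂ (d , d-double , p) | inj₁ j≡j′ =
  grid-separates d 0F [ toℕ i ] [ toℕ j ] p (stay-shift j≡j′) (grid-double-0 d-double)
... | inj₂ (d , d-double , p) | inj₂ (e , e-double , q) =
  grid-separates d e [ toℕ i ] [ toℕ j ] p q (grid-double-double d-double e-double)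

Dist12-clique⇒≤ : ∀ G {k} (f : Fin (suc k) → V G) → (∀ a b → a ≢ b → Dist12 G (f a) (f b)) →
                  ∀ q → HasL11Labeling G q → k ≤ q
Dist12-clique⇒≤ G f clique q (l , l-isL11) = ≮⇒≥ λ q<k →
  let a , b , a<b , la≡lb = pigeonhole (s≤s q<k) (l ∘ f)
  in l-isL11 (f a) (f b) (clique a b (<⇒≢ a<b)) la≡lb

module CornerStar (m n : ℕ) where

  G : Graph
  G = Path (3 + m) ×ᵍ Path (3 + n)

  centre : V G
  centre = 1F , 1F

  corner : Fin 4 → V G
  corner 0F = 0F , 0F
  corner 1F = 0F , 2F
  corner 2F = 2F , 0F
  corner 3F = 2F , 2F

  corner~centre : ∀ c → Adj G (corner c) centre
  corner~centre 0F = inj₁ refl , inj₁ refl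
  corner~centre 1F = inj₁ refl , inj₂ refl
  corner~centre 2F = inj₂ refl , inj₁ refl
  corner~centre 3F = inj₂ refl , inj₂ refl

  centre~corner : ∀ c → Adj G centre (corner c)
  centre~corner 0F = inj₂ refl , inj₂ refl
  centre~corner 1F = inj₂ refl , inj₁ refl
  centre~corner 2F = inj₁ refl , inj₂ refl
  centre~corner 3F = inj₁ refl , inj₁ refl

  star : Fin 5 → V G
  star 0F          = centre
  star (Fin.suc c) = corner c

  code : V G → ℕ
  code (i , j) = toℕ i + 3 * toℕ j

  star-injective : ∀ a b → star a ≡ star b → a ≡ b
  star-injective a b = toWitness {a? = all? λ a → all? λ b →
    (code (star a) ≟ₙ code (star b)) →-dec (a ≟ b)} _ a b ∘ cong code

  star-Dist12 : ∀ a b → a ≢ b → Dist12 G (star a) (star b)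
  star-Dist12 a b a≢b = a≢b ∘ star-injective a b , within-two a b a≢b
    where
    within-two : ∀ a b → a ≢ b → Adj G (star a) (star b) ⊎ ∃[ w ] Adj G (star a) w × Adj G w (star b)
    within-two 0F          0F           0≢0 = ⊥-elim (0≢0 refl)
    within-two 0F          (Fin.suc c)  _   = inj₁ (centre~corner c)
    within-two (Fin.suc c) 0F           _   = inj₁ (corner~centre c)
    within-two (Fin.suc c) (Fin.suc c′) _   = inj₂ (centre , corner~centre c , centre~corner c′)

  star-bound : ∀ q → HasL11Labeling G q → 4 ≤ q
  star-bound = Dist12-clique⇒≤ G star star-Dist12

mainTheorem4 : (m n : ℕ) → m ≥ 3 → n ≥ 3 → λ11≡ (Path m ×ᵍ Path n) 4
mainTheorem4 (suc (suc (suc m))) (suc (suc (suc n))) (s≤s (s≤s (s≤s _))) (s≤s (s≤s (s≤s _))) =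
  (pathProduct-label , pathProduct-label-isL11 (3 + m) (3 + n)) , CornerStar.star-bound m n
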